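{- Let $G$ be a finite sober connected graph with $\mathrm{c\text{ - }rk}\,G=3$ and minimum vertex degree at least 2. Then $\mathrm{Geo}\,G$ is connected if and only if $G$ is not bipartite.
   Context: Graphs are finite, undirected, without loops or multiple edges. $\mathrm{St}(v)$ is the set of neighbours of $v$, $\mathrm{St}(W)=\bigcap_{w\in W}\mathrm{St}(w)$ with $\mathrm{St}(\emptyset)=V$, $\mathrm{Fl}\,G=\{\mathrm{St}(W)\mid W\subseteq V\}$. $G$ is sober if $v\mapsto\mathrm{St}(v)$ is injective. $\mathrm{c\text{ - }rk}\,G$ is the maximum number of independent columns of the $V\times V$ boolean matrix $A^c$ (entry $0$ if $\{i,j\}\in E$, else $1$), where vectors over the superboolean semiring $\{0,1,1^\nu\}$ (with $0+x=x$, $1+1=1^\nu$, $1^\nu+x=1^\nu$, $0\cdot x=0$, $1\cdot1=1$, $1\cdot1^\nu=1^\nu\cdot1^\nu=1^\nu$) are dependent if some $\{0,1\}$-combination with not all coefficients zero has all coordinates in $\{0,1^\nu\}$. $\mathrm{Geo}\,G=(V,\mathcal L_G)$ where $\mathcal L_G=\{W\in\mathrm{Fl}\,G\setminus\{V\}\mid |W|\ge2\}$ (points $V$, lines $\mathcal L_G$). A pair $(P,\mathcal L)$ with $\mathcal L\subseteq 2^P$ is connected if there is no nontrivial partition $\mathcal L=\mathcal L_1\cup\mathcal L_2$ with $(\bigcup\mathcal L_1)\cap(\bigcup\mathcal L_2)=\emptyset$. -}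

module Defs where

open import Data.Nat using (ℕ; _≤_)
open import Data.Bool using (Bool; true; false; if_then_else_; _∧_; _∨_; not)
open import Data.Fin using (Fin)
open import Data.Fin.Subset using (Subset; _∈_; _⊆_; ∣_∣; ⊤)
open import Data.Vec using (tabulate; lookup)
open import Data.List using (List; foldr; map; allFin)
open import Data.Bool.ListAction using (and)
open import Data.Empty using (⊥)
open import Data.Product using (Σ; ∃; _×_)
open import Relation.Nullary using (¬_)
open import Relation.Binary.PropositionalEquality using (_≡_; _≢_)

record Graph (n : ℕ) : Set where
  field
    adj    : Fin n → Fin n → Bool
    sym    : ∀ u v → adj u v ≡ adj v u
    irrefl : ∀ v → adj v v ≡ false
open Graph public

module _ {n : ℕ} (G : Graph n) where

  St : Fin n → Subset n
  St v = tabulate (adj G v)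

  -- St(W) = intersection of St(w), w ∈ W  (St(∅) = V)
  StW : Subset n → Subset n
  StW W = tabulate λ x → and (map (λ w → not (lookup W w) ∨ adj G w x) (allFin n))

  InFl : Subset n → Set
  InFl S = ∃ λ W → StW W ≡ S

  Sober : Set
  Sober = ∀ u v → St u ≡ St v → u ≡ v

  data Reach : Fin n → Fin n → Set where
    here : ∀ {v} → Reach v v
    step : ∀ {u v w} → adj G u v ≡ true → Reach v w → Reach u w

  ConnectedGraph : Set
  ConnectedGraph = ∀ u v → Reach u v

  MinDegree≥2 : Set
  MinDegree≥2 = ∀ v → 2 ≤ ∣ St v ∣

  Bipartite : Set
  Bipartite = ∃ λ (c : Fin n → Bool) → ∀ u v → adj G u v ≡ true → c u ≢ c v

-- The superboolean semiring {0, 1, 1^ν}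
data SB : Set where
  𝟘 𝟙 𝟙ν : SB

_⊕_ : SB → SB → SB
𝟘 ⊕ x = x
𝟙 ⊕ 𝟘 = 𝟙
𝟙 ⊕ 𝟙 = 𝟙ν
𝟙 ⊕ 𝟙ν = 𝟙ν
𝟙ν ⊕ x = 𝟙ν

_⊗_ : SB → SB → SB
𝟘 ⊗ x = 𝟘
𝟙 ⊗ 𝟘 = 𝟘
𝟙 ⊗ 𝟙 = 𝟙
𝟙 ⊗ 𝟙ν = 𝟙ν
𝟙ν ⊗ 𝟘 = 𝟘
𝟙ν ⊗ 𝟙 = 𝟙ν
𝟙ν ⊗ 𝟙ν = 𝟙ν

fromBool : Bool → SB
fromBool true = 𝟙
fromBool false = 𝟘

module _ {n : ℕ} (G : Graph n) where

  Ac : Fin n → Fin n → SB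
  Ac i j = if adj G i j then 𝟘 else 𝟙

  -- i-th coordinate of the {0,1}-combination Σ_j c_j · (column j of A^c)
  comb : Subset n → Fin n → SB
  comb c i = foldr _⊕_ 𝟘 (map (λ j → fromBool (lookup c j) ⊗ Ac i j) (allFin n))

  DependentCols : Subset n → Set
  DependentCols J = Σ (Subset n) λ c →
    c ⊆ J × (∃ λ j → j ∈ c) × (∀ i → comb c i ≢ 𝟙)

  IndependentCols : Subset n → Set
  IndependentCols J = ¬ DependentCols J

  CRank≡ : ℕ → Set
  CRank≡ k = (∃ λ J → IndependentCols J × ∣ J ∣ ≡ k)
           × (∀ J → IndependentCols J → ∣ J ∣ ≤ k)

  IsLine : Subset n → Set
  IsLine W = InFl G W × W ≢ ⊤ × 2 ≤ ∣ W ∣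

  -- Geo G is connected: no nontrivial partition L = L₁ ∪ L₂ (given by a
  -- side assignment) with (⋃ L₁) ∩ (⋃ L₂) = ∅
  GeoConnected : Set
  GeoConnected = ¬ (Σ (Subset n → Bool) λ side →
      (∃ λ L → IsLine L × side L ≡ true)
    × (∃ λ L → IsLine L × side L ≡ false)
    × (∀ L L′ x → IsLine L → side L ≡ true → IsLine L′ → side L′ ≡ false
                → x ∈ L → x ∈ L′ → ⊥))

module Submission where

-- Every line of Geo G is a flat St(W) ≠ V; since St(∅) = V, the
-- set W is nonempty, so every line lies inside a neighbourhood St(w).  Under
-- minimum degree ≥ 2 every neighbourhood St(x) = St({x}) is itself a line.
-- Two neighbourhoods St(x), St(z) meet exactly when x and z have a common
-- neighbour, so Geo G is connected iff "having a common neighbour" connects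
-- all vertices, i.e. iff G is not bipartite:
--  * a 2-colouring of G makes every line monochromatic (all its points are
--    neighbours of one vertex), so "the colour of the points of L" splits
--    the lines into two non-empty classes that never meet;
--  * a splitting of the lines induces the vertex colouring v ↦ side(St v);
--    it is constant across common neighbours, so if it failed to be proper
--    on one edge it would be constant on the connected graph G, and then
--    every line would lie on one side.  The hypotheses on
-- soberness and on the c-rank are needed only to know that G has a vertex.

open import Defs
open import Data.Bool using (Bool; true; false; not; _∨_)
open import Data.Bool.ListAction using (all)
open import Data.Bool.Properties using (T-≡; ¬-not)
open import Data.Empty using (⊥; ⊥-elim)
open import Data.Fin using (Fin)
open import Data.Fin.Subset using (Subset; _∈_; _⊆_; ∣_∣; ⊤; ⁅_⁆; Nonempty; Empty)
open import Data.Fin.Subset.Properties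
  using (∈⊤; x∈⁅x⁆; x∈⁅y⁆⇒x≡y; ⊆-antisym; nonempty?; Empty-unique; ∣⊥∣≡0)
open import Data.List using (allFin)
open import Data.List.Relation.Unary.All.Properties using (all⁺; all⁻; tabulate⁺; tabulate⁻)
open import Data.Nat using (ℕ; _≤_; s≤s; z≤n)
open import Data.Nat.Properties using (≤-trans)
open import Data.Product using (_×_; _,_; proj₁; proj₂; ∃)
open import Data.Vec using (lookup; tabulate)
open import Data.Vec.Properties using (lookup∘tabulate; []=⇒lookup; lookup⇒[]=)
open import Function.Bundles using (_⇔_; mk⇔; module Equivalence)
open Equivalence using (to; from)
open import Relation.Nullary using (¬_; yes; no)
import Relation.Binary.PropositionalEquality as ≡
open ≡ using (_≡_; _≢_; refl; trans; subst)

∈-tabulate : ∀ {n} {f : Fin n → Bool} {x : Fin n} → x ∈ tabulate f ⇔ f x ≡ true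
∈-tabulate {f = f} {x} = mk⇔
  (λ x∈ → trans (≡.sym (lookup∘tabulate f x)) ([]=⇒lookup x∈))
  (λ fx → lookup⇒[]= x _ (trans (lookup∘tabulate f x) fx))

nonempty-of-size : ∀ {n} (p : Subset n) → 1 ≤ ∣ p ∣ → Nonempty p
nonempty-of-size {n} p size with nonempty? p
... | yes ne = ne
... | no empty with subst (λ q → 1 ≤ ∣ q ∣) (Empty-unique empty) size
...   | size∅ with subst (1 ≤_) (∣⊥∣≡0 n) size∅
...     | ()

all-true : ∀ {n} (f : Fin n → Bool) → all f (allFin n) ≡ true ⇔ (∀ i → f i ≡ true)
all-true {n} f = mk⇔
  (λ e i → to T-≡ (tabulate⁻ (all⁺ f (allFin n) (from T-≡ e)) i))
  (λ h → to T-≡ (all⁻ f (tabulate⁺ (λ i → from T-≡ (h i)))))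

implication-true : ∀ {b a : Bool} → not b ∨ a ≡ true ⇔ (b ≡ true → a ≡ true)
implication-true {false} = mk⇔ (λ _ ()) (λ _ → refl)
implication-true {true}  = mk⇔ (λ a _ → a) (λ h → h refl)

true≢false : true ≢ false
true≢false ()

≢-same : ∀ {a b c : Bool} → a ≢ c → b ≢ c → a ≡ b
≢-same a≢c b≢c = trans (¬-not a≢c) (≡.sym (¬-not b≢c))

both-sides : ∀ {A : Set} (line : A → Set) (side : A → Bool) {L L′ : A}
  → line L → line L′ → side L ≢ side L′
  → (∃ λ M → line M × side M ≡ true) × (∃ λ M → line M × side M ≡ false)
both-sides line side {L} {L′} l l′ differ with side L in s | side L′ in s′
... | true  | true  = ⊥-elim (differ refl)
... | true  | false = (L , l , s) , (L′ , l′ , s′)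
... | false | true  = (L′ , l′ , s′) , (L , l , s)
... | false | false = ⊥-elim (differ refl)

module _ {n : ℕ} (G : Graph n) where

  ∈-St : ∀ {x y} → y ∈ St G x ⇔ adj G x y ≡ true
  ∈-St = ∈-tabulate

  ∈-StW : ∀ {W x} → x ∈ StW G W ⇔ (∀ {w} → w ∈ W → adj G w x ≡ true)
  ∈-StW {W} {x} = mk⇔
    (λ x∈ {w} w∈ → to implication-true (to (all-true conjunct) (to ∈-tabulate x∈) w) ([]=⇒lookup w∈))
    (λ h → from ∈-tabulate (from (all-true conjunct)
      (λ w → from implication-true (λ w∈ → h (lookup⇒[]= w W w∈)))))
    where
    conjunct : Fin n → Bool
    conjunct w = not (lookup W w) ∨ adj G w x

  StW-singleton : ∀ x → StW G ⁅ x ⁆ ≡ St G x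
  StW-singleton x = ⊆-antisym
    (λ y∈ → from ∈-St (to ∈-StW y∈ (x∈⁅x⁆ x)))
    (λ {y} y∈ → from ∈-StW λ {w} w∈ →
      subst (λ v → adj G v y ≡ true) (≡.sym (x∈⁅y⁆⇒x≡y x w∈)) (to ∈-St y∈))

  StW-empty : ∀ {W} → Empty W → StW G W ≡ ⊤
  StW-empty empty = ⊆-antisym (λ _ → ∈⊤) (λ _ → from ∈-StW λ {w} w∈ → ⊥-elim (empty (w , w∈)))

  St≢⊤ : ∀ x → St G x ≢ ⊤
  St≢⊤ x St≡⊤ = true≢false (trans (≡.sym loop) (irrefl G x))
    where
    loop : adj G x x ≡ true
    loop = to ∈-St (subst (x ∈_) (≡.sym St≡⊤) ∈⊤)

  St-isLine : MinDegree≥2 G → ∀ x → IsLine G (St G x)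
  St-isLine md x = (⁅ x ⁆ , StW-singleton x) , St≢⊤ x , md x

  line⊆St : ∀ {L} → IsLine G L → ∃ λ x → L ⊆ St G x
  line⊆St ((W , refl) , L≢⊤ , _) with nonempty? W
  ... | yes (w , w∈) = w , λ x∈ → from ∈-St (to ∈-StW x∈ w∈)
  ... | no empty = ⊥-elim (L≢⊤ (StW-empty empty))

  line-nonempty : ∀ {L} → IsLine G L → Nonempty L
  line-nonempty {L} (_ , _ , size) = nonempty-of-size L (≤-trans (s≤s z≤n) size)

  constant-on-walks : ∀ {A : Set} (f : Fin n → A)
    → (∀ {x y z} → adj G x y ≡ true → adj G y z ≡ true → f x ≡ f z)
    → ∀ {u v w} → adj G u v ≡ true → f v ≡ f u → Reach G v w → f w ≡ f u
  constant-on-walks f common uv fv≡fu here = fv≡fu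
  constant-on-walks f common uv fv≡fu (step vy walk) =
    trans (constant-on-walks f common vy (trans (≡.sym (common uv vy)) (≡.sym fv≡fu)) walk) fv≡fu

  -- The condition refuted by GeoConnected: lines on different sides never meet.
  Separating : (Subset n → Bool) → Set
  Separating side = ∀ L L′ x → IsLine G L → side L ≡ true → IsLine G L′ → side L′ ≡ false
    → x ∈ L → x ∈ L′ → ⊥

  meeting-same-side : ∀ {side} → Separating side → ∀ {L L′ x} → IsLine G L → IsLine G L′
    → x ∈ L → x ∈ L′ → side L ≡ side L′
  meeting-same-side {side} sep {L} {L′} {x} l l′ x∈ x∈′ with side L in s | side L′ in s′
  ... | true  | true  = refl
  ... | false | false = refl
  ... | true  | false = ⊥-elim (sep L L′ x l s l′ s′ x∈ x∈′)
  ... | false | true  = ⊥-elim (sep L′ L x l′ s′ l s x∈′ x∈)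

  geoConnected-if-nonBipartite : MinDegree≥2 G → ConnectedGraph G → ¬ Bipartite G → GeoConnected G
  geoConnected-if-nonBipartite md conn nonBip (side , (L₁ , l₁ , side₁) , (L₂ , l₂ , side₂) , sep) =
    nonBip (colour , proper)
    where
    colour : Fin n → Bool
    colour v = side (St G v)

    common-neighbour : ∀ {x y z} → adj G x y ≡ true → adj G y z ≡ true → colour x ≡ colour z
    common-neighbour {x} {y} {z} xy yz = meeting-same-side sep (St-isLine md x) (St-isLine md z)
      (from ∈-St xy) (from ∈-St (trans (Graph.sym G z y) yz))

    line-colour : ∀ {L} → IsLine G L → ∃ λ x → side L ≡ colour x
    line-colour l with line⊆St l | line-nonempty l
    ... | x , L⊆St | y , y∈ = x , meeting-same-side sep l (St-isLine md x) y∈ (L⊆St y∈)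

    proper : ∀ u v → adj G u v ≡ true → colour u ≢ colour v
    proper u v uv same with line-colour l₁ | line-colour l₂
    ... | x₁ , c₁ | x₂ , c₂ = true≢false (begin
      true      ≡⟨ ≡.sym side₁ ⟩
      side L₁   ≡⟨ c₁ ⟩
      colour x₁ ≡⟨ constant x₁ ⟩
      colour u  ≡⟨ ≡.sym (constant x₂) ⟩
      colour x₂ ≡⟨ ≡.sym c₂ ⟩
      side L₂   ≡⟨ side₂ ⟩
      false     ∎)
      where
      open ≡.≡-Reasoning
      constant : ∀ w → colour w ≡ colour u
      constant w = constant-on-walks colour common-neighbour uv (≡.sym same) (conn v w)

  nonBipartite-if-geoConnected : MinDegree≥2 G → Fin n → GeoConnected G → ¬ Bipartite G
  nonBipartite-if-geoConnected md v₀ geo (colour , proper) =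
    geo (side , proj₁ both-used , proj₂ both-used , separating)
    where
    -- all points of a line are neighbours of one vertex, hence share a colour
    monochromatic : ∀ {L x y} → IsLine G L → x ∈ L → y ∈ L → colour x ≡ colour y
    monochromatic l x∈ y∈ with line⊆St l
    ... | c , L⊆St = ≢-same (λ e → proper c _ (to ∈-St (L⊆St x∈)) (≡.sym e))
                            (λ e → proper c _ (to ∈-St (L⊆St y∈)) (≡.sym e))

    side : Subset n → Bool
    side L with nonempty? L
    ... | yes (x , _) = colour x
    ... | no _ = false

    side-at : ∀ {L x} → IsLine G L → x ∈ L → side L ≡ colour x
    side-at {L} l x∈ with nonempty? L
    ... | yes (y , y∈) = monochromatic l y∈ x∈
    ... | no empty = ⊥-elim (empty (_ , x∈))

    separating : Separating side
    separating L L′ x l s l′ s′ x∈ x∈′ =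
      true≢false (trans (≡.sym s) (trans (side-at l x∈) (trans (≡.sym (side-at l′ x∈′)) s′)))

    w₀ : Fin n
    w₀ = proj₁ (line-nonempty (St-isLine md v₀))

    v₀w₀ : adj G v₀ w₀ ≡ true
    v₀w₀ = to ∈-St (proj₂ (line-nonempty (St-isLine md v₀)))

    differ : side (St G v₀) ≢ side (St G w₀)
    differ e = proper v₀ w₀ v₀w₀ (begin
      colour v₀      ≡⟨ ≡.sym (side-at (St-isLine md w₀) (from ∈-St (trans (Graph.sym G w₀ v₀) v₀w₀))) ⟩
      side (St G w₀) ≡⟨ ≡.sym e ⟩
      side (St G v₀) ≡⟨ side-at (St-isLine md v₀) (from ∈-St v₀w₀) ⟩
      colour w₀      ∎)
      where open ≡.≡-Reasoning

    both-used : (∃ λ L → IsLine G L × side L ≡ true) × (∃ λ L → IsLine G L × side L ≡ false)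
    both-used = both-sides (IsLine G) side (St-isLine md v₀) (St-isLine md w₀) differ

proposition6p4 : ∀ {n : ℕ} (G : Graph n) → Sober G → ConnectedGraph G
    → CRank≡ G 3 → MinDegree≥2 G → (GeoConnected G ⇔ (¬ Bipartite G))
proposition6p4 {n} G _ conn ((J , _ , ∣J∣≡3) , _) md =
  mk⇔ (nonBipartite-if-geoConnected G md v₀) (geoConnected-if-nonBipartite G md conn)
  where
  -- three independent columns exist, so G has a vertex
  v₀ : Fin n
  v₀ = proj₁ (nonempty-of-size J (subst (1 ≤_) (≡.sym ∣J∣≡3) (s≤s z≤n)))
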